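{- There exist a finite alphabet $\Sigma$, a language $L\subseteq\Sigma^*$, and an open edit-based violation measure $m$ for $L$ such that the tightest contractible approximation $m^*$ of $m$ cannot be expressed as a proper open edit-based violation measure on any language; that is, there is no language $L'\subseteq\Sigma^*$ and weights $\alpha',\beta',\gamma',\delta'$ such that the open edit-based violation measure $m'$ for $L'$ with these weights satisfies $m'(w)=0\iff w\in P(L')$ for all $w\in\Sigma^*$ and $m'=m^*$.
   Context: $P(L)=\{w\mid\exists u\; wu\in L\}$ is the prefix-closure of $L$. Edit operations on words: substitution of a letter, insertion of a letter, deletion of a letter, transposition of two adjacent letters. Given non-negative weights $\alpha,\beta,\gamma,\delta$, the open edit-based violation measure for $L$ is $m(w)=\min(\alpha n_s+\beta n_i+\gamma n_d+\delta n_t)$ over all edit sequences transforming $w$ into an element of $P(L)$, with $n_s,n_i,n_d,n_t$ the numbers of substitutions, insertions, deletions, transpositions. A function $f$ from words to non-negative reals is contractible if $f(wa)\ge f(w)$ for every word $w$ and letter $a$. A function $m_1$ is an approximation of $m$ if $m_1(w)\le m(w)$ for all words $w$. The tightest contractible approximation $m^*$ of $m$ is the contractible approximation of $m$ such that every contractible approximation $k$ of $m$ satisfies $k\le m^*$ pointwise (it is given by $m^*(w)=\inf_{u}m(wu)$).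
   Formalization: The weights $\alpha',\beta',\gamma',\delta'$ of the excluded measure $m'$, like the weights of $m$, are taken in the non-negative rationals, and the compared measure values are rational. -}

module Defs where

open import Data.Nat using (ℕ)
open import Data.List using (List; []; _∷_; _++_)
open import Data.Product using (Σ; ∃; _×_; _,_)
open import Data.Rational using (ℚ; 0ℚ; _≤_; _+_)

P : {A : Set} → (List A → Set) → List A → Set
P L w = ∃ λ u → L (w ++ u)

data Kind : Set where
  subst ins del trans : Kind

data Step {A : Set} : Kind → List A → List A → Set where
  subst : (x y : A) (u v : List A) → Step subst (u ++ x ∷ v) (u ++ y ∷ v)
  ins   : (y : A) (u v : List A) → Step ins (u ++ v) (u ++ y ∷ v)
  del   : (x : A) (u v : List A) → Step del (u ++ x ∷ v) (u ++ v)
  trans : (x y : A) (u v : List A) → Step trans (u ++ x ∷ y ∷ v) (u ++ y ∷ x ∷ v)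

record Weights : Set where
  field
    α β γ δ : ℚ
    α≥0 : 0ℚ ≤ α
    β≥0 : 0ℚ ≤ β
    γ≥0 : 0ℚ ≤ γ
    δ≥0 : 0ℚ ≤ δ

weight : Weights → Kind → ℚ
weight W subst = Weights.α W
weight W ins   = Weights.β W
weight W del   = Weights.γ W
weight W trans = Weights.δ W

data Edits {A : Set} (W : Weights) : List A → List A → ℚ → Set where
  done : ∀ {w} → Edits W w w 0ℚ
  step : ∀ {k w v z c} → Step k w v → Edits W v z c → Edits W w z (weight W k + c)

IsInf : (ℚ → Set) → ℚ → Set
IsInf S r = (∀ q → S q → r ≤ q) × (∀ s → (∀ q → S q → s ≤ q) → s ≤ r)

-- MeasureValue W L w r  :⇔  m(w) = r, where m is the open edit-based violation
-- measure for L with weights W (minimum = infimum of costs of edit sequences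
-- turning w into an element of P(L)).  If no such value exists, m(w) = +∞.
MeasureValue : {A : Set} → Weights → (List A → Set) → List A → ℚ → Set
MeasureValue W L w r = IsInf (λ c → ∃ λ v → P L v × Edits W w v c) r

-- TightestValue W L w r  :⇔  m*(w) = r, where m*(w) = inf_u m(wu)
TightestValue : {A : Set} → Weights → (List A → Set) → List A → ℚ → Set
TightestValue W L w r = IsInf (λ q → ∃ λ u → MeasureValue W L (w ++ u) q) r

{-# OPTIONS --safe #-}
module Submission where

-- Take L = {AC, BDD} over {A, B, C, D} with α = β = γ = 2 and δ = 1. Then m*
-- vanishes on P(L), m*(C) = 1 (append A and transpose CA into AC), and
-- m*(DD) = m*(DA) = 2: a word DD… or DA… is outside P(L), and either its first
-- repair step costs 2 or it is a transposition (cost 1) to a word D… or AD…,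
-- again outside P(L) and so needing at least one more step.
-- If m* were an open measure m' for L' with weights α', β', γ', δ', then
-- P(L) ⊆ P(L'), and the one-step repairs DD ↦ BD, DD ↦ BDD, DA ↦ A give
-- α', β', γ' ≥ 2. But C ∉ P(L') and a one-letter word admits no transposition,
-- so m'(C) ≥ 2 ≠ 1.

open import Defs
open import Data.Nat using (ℕ)
open import Data.Fin using (Fin; zero; suc)
open import Data.List using (List; []; _∷_; _++_)
open import Data.List.Properties using (++-identityʳ)
open import Data.Product using (Σ; ∃; _×_; _,_; proj₁; proj₂)
open import Data.Sum using (_⊎_; inj₁; inj₂)
open import Data.Empty using (⊥-elim)
open import Data.Rational using (ℚ; 0ℚ; 1ℚ; _≤_; _+_; _≤?_)
open import Data.Rational.Properties using (≤-refl; ≤-reflexive; ≤-trans; +-mono-≤; +-monoʳ-≤; +-identityʳ)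
open import Function.Bundles using (_⇔_; Equivalence)
open import Relation.Nullary using (¬_)
open import Relation.Nullary.Decidable using (True; False; toWitness; toWitnessFalse)
open import Relation.Binary.PropositionalEquality as ≡ using (_≡_; _≢_; refl; sym)

≤-decide : ∀ {p q : ℚ} {_ : True (p ≤? q)} → p ≤ q
≤-decide {_} {_} {p≤q} = toWitness p≤q

≰-decide : ∀ {p q : ℚ} {_ : False (p ≤? q)} → ¬ p ≤ q
≰-decide {_} {_} {p≰q} = toWitnessFalse p≰q

weight-nonneg : ∀ W k → 0ℚ ≤ weight W k
weight-nonneg W subst = Weights.α≥0 W
weight-nonneg W ins   = Weights.β≥0 W
weight-nonneg W del   = Weights.γ≥0 W
weight-nonneg W trans = Weights.δ≥0 W

Edits-nonneg : ∀ {X : Set} {W} {w v : List X} {c} → Edits W w v c → 0ℚ ≤ c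
Edits-nonneg done = ≤-refl
Edits-nonneg {W = W} (step {k = k} _ e) = +-mono-≤ (weight-nonneg W k) (Edits-nonneg e)

isInf-attained : ∀ {S : ℚ → Set} {r} → S r → (∀ q → S q → r ≤ q) → IsInf S r
isInf-attained r∈S r≤S = r≤S , λ s s≤S → s≤S _ r∈S

module EditMeasure {X : Set} (W : Weights) (L : List X → Set) where

  RepairCost≥ : ℚ → List X → Set
  RepairCost≥ a w = ∀ {v c} → Edits W w v c → P L v → a ≤ c

  repairCost≥0 : ∀ {w} → RepairCost≥ 0ℚ w
  repairCost≥0 e _ = Edits-nonneg e

  repairCost≥-step : ∀ {a w} → ¬ P L w →
    (∀ {k v} → Step k w v → ∃ λ b → RepairCost≥ b v × a ≤ weight W k + b) →
    RepairCost≥ a w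
  repairCost≥-step w∉P _ done v∈P = ⊥-elim (w∉P v∈P)
  repairCost≥-step _ bound (step {k = k} s e) v∈P with bound s
  ... | _ , rest , a≤ = ≤-trans a≤ (+-monoʳ-≤ (weight W k) (rest e v∈P))

  repairCost≥-firstStep : ∀ {a w} → ¬ P L w →
    (∀ {k v} → Step k w v → a ≤ weight W k) → RepairCost≥ a w
  repairCost≥-firstStep w∉P bound = repairCost≥-step w∉P λ s →
    0ℚ , repairCost≥0 , ≤-trans (bound s) (≤-reflexive (sym (+-identityʳ _)))

  repairCost≥-singleton : ∀ {a x} → ¬ P L (x ∷ []) →
    a ≤ Weights.α W → a ≤ Weights.β W → a ≤ Weights.γ W → RepairCost≥ a (x ∷ [])
  repairCost≥-singleton {a} {x} x∉P a≤α a≤β a≤γ = repairCost≥-firstStep x∉P first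
    where
    -- The word is abstracted behind an equation: Agda cannot unify u ++ x ∷ y ∷ v with x ∷ [].
    no-transposition : ∀ {w v} → Step trans w v → w ≢ x ∷ []
    no-transposition (trans _ _ [] _) ()
    no-transposition (trans _ _ (_ ∷ []) _) ()
    no-transposition (trans _ _ (_ ∷ _ ∷ _) _) ()

    first : ∀ {k v} → Step k (x ∷ []) v → a ≤ weight W k
    first {subst} _ = a≤α
    first {ins}   _ = a≤β
    first {del}   _ = a≤γ
    first {trans} s = ⊥-elim (no-transposition s refl)

  measureValue-≤-cost : ∀ {w v r c} → MeasureValue W L w r → Edits W w v c → P L v → r ≤ c
  measureValue-≤-cost m e v∈P = proj₁ m _ (_ , v∈P , e)

  measureValue-≤-weight : ∀ {k w v r} → MeasureValue W L w r → Step k w v → P L v → r ≤ weight W k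
  measureValue-≤-weight m s v∈P =
    ≤-trans (measureValue-≤-cost m (step s done) v∈P) (≤-reflexive (+-identityʳ _))

  measureValue-≥ : ∀ {a w r} → MeasureValue W L w r → RepairCost≥ a w → a ≤ r
  measureValue-≥ m a≤ = proj₂ m _ λ _ (_ , v∈P , e) → a≤ e v∈P

  measureValue-attained : ∀ {w v c} → Edits W w v c → P L v → RepairCost≥ c w →
    MeasureValue W L w c
  measureValue-attained e v∈P c≤ = isInf-attained (_ , v∈P , e) λ _ (_ , v′∈P , e′) → c≤ e′ v′∈P

  measureValue-step : ∀ {k w v} → Step k w v → P L v → RepairCost≥ (weight W k) w →
    MeasureValue W L w (weight W k)
  measureValue-step s v∈P k≤ = ≡.subst (MeasureValue W L _) (+-identityʳ _)
    (measureValue-attained (step s done) v∈P λ e v′∈P →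
      ≤-trans (≤-reflexive (+-identityʳ _)) (k≤ e v′∈P))

  measureValue-prefix : ∀ {w} → P L w → MeasureValue W L w 0ℚ
  measureValue-prefix w∈P = measureValue-attained done w∈P repairCost≥0

  tightestValue-attained : ∀ {w r} u → MeasureValue W L (w ++ u) r →
    (∀ u′ → RepairCost≥ r (w ++ u′)) → TightestValue W L w r
  tightestValue-attained u m r≤ = isInf-attained (u , m) λ _ (u′ , m′) → measureValue-≥ m′ (r≤ u′)

  tightestValue-prefix : ∀ {w} → P L w → TightestValue W L w 0ℚ
  tightestValue-prefix {w} (u , wu∈L) = tightestValue-attained []
    (measureValue-prefix (u , ≡.subst (λ z → L (z ++ u)) (sym (++-identityʳ w)) wu∈L))
    λ _ → repairCost≥0

pattern A = zero
pattern B = suc zero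
pattern C = suc (suc zero)
pattern D = suc (suc (suc zero))

data L₀ : List (Fin 4) → Set where
  AC  : L₀ (A ∷ C ∷ [])
  BDD : L₀ (B ∷ D ∷ D ∷ [])

2ℚ : ℚ
2ℚ = 1ℚ + 1ℚ

W₀ : Weights
W₀ = record { α = 2ℚ ; β = 2ℚ ; γ = 2ℚ ; δ = 1ℚ
            ; α≥0 = ≤-decide ; β≥0 = ≤-decide ; γ≥0 = ≤-decide ; δ≥0 = ≤-decide }

open EditMeasure W₀ L₀

C∷-∉P : ∀ w → ¬ P L₀ (C ∷ w)
C∷-∉P _ (_ , ())

D∷-∉P : ∀ w → ¬ P L₀ (D ∷ w)
D∷-∉P _ (_ , ())

AD∷-∉P : ∀ w → ¬ P L₀ (A ∷ D ∷ w)
AD∷-∉P _ (_ , ())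

W₀-repairCost≥1 : ∀ {w} → ¬ P L₀ w → RepairCost≥ 1ℚ w
W₀-repairCost≥1 w∉P = repairCost≥-firstStep w∉P λ {k} _ → 1≤weight k
  where
  1≤weight : ∀ k → 1ℚ ≤ weight W₀ k
  1≤weight subst = ≤-decide
  1≤weight ins   = ≤-decide
  1≤weight del   = ≤-decide
  1≤weight trans = ≤-decide

transpose-D∷-∉P : ∀ {y r w v} → y ≡ D ⊎ y ≡ A → Step trans w v → w ≡ D ∷ y ∷ r → ¬ P L₀ v
transpose-D∷-∉P (inj₁ refl) (trans _ _ [] _) refl = D∷-∉P _
transpose-D∷-∉P (inj₂ refl) (trans _ _ [] _) refl = AD∷-∉P _
transpose-D∷-∉P _ (trans _ _ (_ ∷ []) _) refl = D∷-∉P _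
transpose-D∷-∉P _ (trans _ _ (_ ∷ _ ∷ _) _) refl = D∷-∉P _

W₀-repairCost≥2-D∷ : ∀ {y} r → y ≡ D ⊎ y ≡ A → RepairCost≥ 2ℚ (D ∷ y ∷ r)
W₀-repairCost≥2-D∷ {y} r y∈DA = repairCost≥-step (D∷-∉P _) bound
  where
  bound : ∀ {k v} → Step k (D ∷ y ∷ r) v → ∃ λ b → RepairCost≥ b v × 2ℚ ≤ weight W₀ k + b
  bound {subst} _ = 0ℚ , repairCost≥0 , ≤-decide
  bound {ins}   _ = 0ℚ , repairCost≥0 , ≤-decide
  bound {del}   _ = 0ℚ , repairCost≥0 , ≤-decide
  bound {trans} s = 1ℚ , W₀-repairCost≥1 (transpose-D∷-∉P y∈DA s refl) , ≤-decide

m*-C : TightestValue W₀ L₀ (C ∷ []) 1ℚ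
m*-C = tightestValue-attained (A ∷ [])
  (measureValue-step (trans C A [] []) ([] , AC) (W₀-repairCost≥1 (C∷-∉P _)))
  λ u → W₀-repairCost≥1 (C∷-∉P u)

m*-DD : TightestValue W₀ L₀ (D ∷ D ∷ []) 2ℚ
m*-DD = tightestValue-attained []
  (measureValue-step (subst D B [] (D ∷ [])) (D ∷ [] , BDD) (W₀-repairCost≥2-D∷ [] (inj₁ refl)))
  λ u → W₀-repairCost≥2-D∷ u (inj₁ refl)

m*-DA : TightestValue W₀ L₀ (D ∷ A ∷ []) 2ℚ
m*-DA = tightestValue-attained []
  (measureValue-step (del D [] (A ∷ [])) (C ∷ [] , AC) (W₀-repairCost≥2-D∷ [] (inj₂ refl)))
  λ u → W₀-repairCost≥2-D∷ u (inj₂ refl)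

theorem4 : Σ ℕ λ k → Σ (List (Fin k) → Set) λ L → Σ Weights λ W →
    ¬ (Σ (List (Fin k) → Set) λ L' → Σ Weights λ W' →
         ((w : List (Fin k)) → MeasureValue W' L' w 0ℚ ⇔ P L' w)
       × ((w : List (Fin k)) (r : ℚ) → MeasureValue W' L' w r ⇔ TightestValue W L w r))
theorem4 = 4 , L₀ , W₀ , λ (L′ , W′ , zero⇔prefix , m′⇔m*) → let
    module M′ = EditMeasure W′ L′

    m′ : ∀ {w r} → TightestValue W₀ L₀ w r → MeasureValue W′ L′ w r
    m′ = Equivalence.from (m′⇔m* _ _)

    P-L₀⊆P-L′ : ∀ {w} → P L₀ w → P L′ w
    P-L₀⊆P-L′ w∈P = Equivalence.to (zero⇔prefix _) (m′ (tightestValue-prefix w∈P))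

    2≤α′ : 2ℚ ≤ Weights.α W′
    2≤α′ = M′.measureValue-≤-weight (m′ m*-DD) (subst D B [] (D ∷ [])) (P-L₀⊆P-L′ (D ∷ [] , BDD))
    2≤β′ : 2ℚ ≤ Weights.β W′
    2≤β′ = M′.measureValue-≤-weight (m′ m*-DD) (ins B [] (D ∷ D ∷ [])) (P-L₀⊆P-L′ ([] , BDD))
    2≤γ′ : 2ℚ ≤ Weights.γ W′
    2≤γ′ = M′.measureValue-≤-weight (m′ m*-DA) (del D [] (A ∷ [])) (P-L₀⊆P-L′ (C ∷ [] , AC))

    C∉P-L′ : ¬ P L′ (C ∷ [])
    C∉P-L′ C∈P = ≰-decide (M′.measureValue-≤-cost (m′ m*-C) done C∈P)
  in ≰-decide (M′.measureValue-≥ (m′ m*-C) (M′.repairCost≥-singleton C∉P-L′ 2≤α′ 2≤β′ 2≤γ′))
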